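{- Let $k\ge 3$ and let $G'$ be the graph constructed (as described in the context) from a Min-Rep instance whose supergraph $\tilde G$ has girth at least $k+2$. Then in any $k$-spanner $H$ of $G'$, every edge of $E_{\tilde G}$ is either included in $H$ or is spanned in $H$ by a canonical path.
   Context: Min-Rep instance: a bipartite supergraph $\tilde G=(A,B,\tilde E)$ with $|A|=|B|=\tilde n/2$, alphabets $\Sigma_A,\Sigma_B$, nonempty relations $\pi_e\subseteq\Sigma_A\times\Sigma_B$ for $e\in\tilde E$, and Min-Rep graph $G=(A\times\Sigma_A,B\times\Sigma_B,E)$ where $((i,\alpha),(j,\beta))\in E$ iff $(i,j)\in\tilde E$ and $(\alpha,\beta)\in\pi_{(i,j)}$. Let $A_i=\{(i,\alpha):\alpha\in\Sigma_A\}$, $B_j=\{(j,\beta):\beta\in\Sigma_B\}$, $n=|A||\Sigma_A|+|B||\Sigma_B|$, $k_A=\lfloor\frac{k-1}{2}\rfloor$, $k_B=\lceil\frac{k-1}{2}\rceil$, $x=n^2/\tilde n$, $[m]=\{1,\dots,m\}$. Define new vertices $S=\{s^p_{ij}: i\in A, j\in[k_A], p\in[x]\}$ and $T=\{t^p_{ij}: i\in B, j\in[k_B], p\in[x]\}$. $G'$ has vertex set $(A\times\Sigma_A)\cup(B\times\Sigma_B)\cup S\cup T$ and edge set $E\cup E_M\cup E_{sA}\cup E_{tB}\cup E_{\tilde G}$, where $E_M=\{(s^p_{ij},s^p_{i(j+1)}): p\in[x], i\in A, j\in[k_A-1]\}\cup\{(t^p_{ij},t^p_{i(j+1)}): p\in[x],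 i\in B, j\in[k_B-1]\}$, $E_{sA}=\{(s^p_{i1},u): i\in A, u\in A_i, p\in[x]\}$, $E_{tB}=\{(w,t^p_{j1}): j\in B, w\in B_j, p\in[x]\}$, $E^p_{\tilde G}=\{(s^p_{ik_A},t^p_{jk_B}): (i,j)\in\tilde E\}$, and $E_{\tilde G}=\bigcup_{p\in[x]}E^p_{\tilde G}$. For an edge $(s^p_{ik_A},t^p_{jk_B})\in E^p_{\tilde G}$, a canonical path is a path of the form $s^p_{ik_A},s^p_{i(k_A-1)},\dots,s^p_{i1},u,w,t^p_{j1},\dots,t^p_{jk_B}$ with $u\in A_i$, $w\in B_j$, $(u,w)\in E$. A $k$-spanner of $G'$ is a subgraph $H$ on the same vertex set with $\mathrm{dist}_H(a,b)\le k\,\mathrm{dist}_{G'}(a,b)$ for all vertices $a,b$. -}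

module Defs where

open import Data.Nat using (ℕ; zero; suc; _+_; _*_; _∸_; _≤_; _/_)
open import Data.Fin using (Fin; toℕ)
open import Data.Sum using (_⊎_; inj₁; inj₂)
open import Data.Product using (Σ; ∃; ∃-syntax; _×_; _,_)
open import Data.Empty using (⊥)
open import Function.Definitions using (Injective)
open import Relation.Binary.PropositionalEquality using (_≡_)

-- Min-Rep instance.  A = B = Fin N (so ñ = 2N), Σ_A = Fin σA, Σ_B = Fin σB.
-- superE i j : (i , j) ∈ Ẽ ;  rel i j α β : (α , β) ∈ π_(i,j).

record MinRep : Set₁ where
  field
    N        : ℕ
    σA       : ℕ
    σB       : ℕ
    superE   : Fin N → Fin N → Set
    rel      : Fin N → Fin N → Fin σA → Fin σB → Set
    rel-nonempty : ∀ i j → superE i j → ∃[ α ] ∃[ β ] rel i j α β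

-- vertices of the supergraph G̃: inj₁ = side A, inj₂ = side B
module Super (I : MinRep) where
  open MinRep I

  SV : Set
  SV = Fin N ⊎ Fin N

  SAdj : SV → SV → Set
  SAdj (inj₁ i) (inj₂ j) = superE i j
  SAdj (inj₂ j) (inj₁ i) = superE i j
  SAdj (inj₁ _) (inj₁ _) = ⊥
  SAdj (inj₂ _) (inj₂ _) = ⊥

  record IsCycle (L : ℕ) (c : Fin L → SV) : Set where
    field
      long    : 3 ≤ L
      inj     : Injective _≡_ _≡_ c
      step    : ∀ (i j : Fin L) → toℕ j ≡ suc (toℕ i) → SAdj (c i) (c j)
      close   : ∀ (i j : Fin L) → toℕ i ≡ L ∸ 1 → toℕ j ≡ 0 → SAdj (c i) (c j)

  GirthAtLeast : ℕ → Set
  GirthAtLeast g = ∀ (L : ℕ) (c : Fin L → SV) → IsCycle L c → g ≤ L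

kA : ℕ → ℕ
kA k = (k ∸ 1) / 2

kB : ℕ → ℕ
kB k = (k ∸ 1) ∸ kA k         -- ⌈(k-1)/2⌉

-- x = n² / ñ  with n = N σA + N σB, ñ = 2N (floor division; 0 if N = 0)
copies : MinRep → ℕ
copies I with MinRep.N I
... | zero  = 0
... | suc m = (n * n) / (2 * suc m)
  where n = suc m * MinRep.σA I + suc m * MinRep.σB I

-- Indices j ∈ [k_A] are represented by Fin (kA k) with
-- toℕ j = j - 1 (so the paper's index 1 is toℕ j ≡ 0 and index k_A is
-- toℕ j ≡ kA k ∸ 1);  likewise p ∈ [x] is Fin (copies I).

module Construction (k : ℕ) (I : MinRep) where
  open MinRep I

  x : ℕ
  x = copies I

  data V : Set where
    va : Fin N → Fin σA → V
    vb : Fin N → Fin σB → V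
    vs : Fin N → Fin (kA k) → Fin x → V       -- s^p_{ij}
    vt : Fin N → Fin (kB k) → Fin x → V       -- t^p_{ij}

  -- directed description of the edge set E ∪ E_M ∪ E_sA ∪ E_tB ∪ E_G̃
  data Edge : V → V → Set where
    eE   : ∀ {i j α β} → superE i j → rel i j α β → Edge (va i α) (vb j β)
    eMs  : ∀ {i j j′ p} → toℕ j′ ≡ suc (toℕ j) → Edge (vs i j p) (vs i j′ p)
    eMt  : ∀ {i j j′ p} → toℕ j′ ≡ suc (toℕ j) → Edge (vt i j p) (vt i j′ p)
    esA  : ∀ {i j α p} → toℕ j ≡ 0 → Edge (vs i j p) (va i α)
    etB  : ∀ {i j β p} → toℕ j ≡ 0 → Edge (vb i β) (vt i j p)
    eG   : ∀ {i j ji jj p} → superE i j → toℕ ji ≡ kA k ∸ 1 → toℕ jj ≡ kB k ∸ 1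
           → Edge (vs i ji p) (vt j jj p)

  Adj : V → V → Set
  Adj u v = Edge u v ⊎ Edge v u

  data Walk (R : V → V → Set) : V → V → ℕ → Set where
    []  : ∀ {v} → Walk R v v 0
    _∷_ : ∀ {u v w ℓ} → R u v → Walk R v w ℓ → Walk R u w (suc ℓ)

  record IsSubgraph (H : V → V → Set) : Set where
    field
      sym-H : ∀ {u v} → H u v → H v u
      sub   : ∀ {u v} → H u v → Adj u v

  -- dist_H(u,v) ≤ k · dist_G'(u,v) for all u, v
  -- (i.e. whenever G' has a u–v walk of length d, H has one of length ≤ k d)
  IsSpanner : (V → V → Set) → Set
  IsSpanner H = ∀ (u v : V) (d : ℕ) → Walk Adj u v d →
                ∃[ ℓ ] (ℓ ≤ k * d × Walk H u v ℓ)

  -- the edge (s^p_{i k_A}, t^p_{j k_B}) is spanned in H by a canonical path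
  -- s^p_{i k_A}, …, s^p_{i1}, u, w, t^p_{j1}, …, t^p_{j k_B}
  -- with u = (i,α) ∈ A_i, w = (j,β) ∈ B_j, (u,w) ∈ E: all its edges lie in H
  CanonicalSpanned : (V → V → Set) → Fin N → Fin N → Fin x → Set
  CanonicalSpanned H i j p =
    ∃[ α ] ∃[ β ]
      ( rel i j α β
      × (∀ (j₁ j₂ : Fin (kA k)) → toℕ j₂ ≡ suc (toℕ j₁) → H (vs i j₂ p) (vs i j₁ p))
      × (∀ (j₁ : Fin (kA k)) → toℕ j₁ ≡ 0 → H (vs i j₁ p) (va i α))
      × H (va i α) (vb j β)
      × (∀ (j₁ : Fin (kB k)) → toℕ j₁ ≡ 0 → H (vb j β) (vt j j₁ p))
      × (∀ (j₁ j₂ : Fin (kB k)) → toℕ j₂ ≡ suc (toℕ j₁) → H (vt j j₁ p) (vt j j₂ p)))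

module Submission where

-- The spanner contains a walk of length at most k from s = s^p_{i k_A} to t = t^p_{j k_B}.
-- Project G′ onto G̃ (every vertex lies over i ∈ A or j ∈ B).  If no step of the walk lies
-- over the superedge ij, its image is an i–j walk avoiding ij, which closes a cycle of length
-- at most k + 1 and contradicts the girth.  Otherwise some step is an E-edge between A_i and
-- B_j or a copy of the superedge ij.  Three 1-Lipschitz potentials (distances to the Min-Rep
-- layer, to B × Σ_B and to the copies other than p) bound the two pieces of the walk around
-- that step from below; as k = 1 + k_A + k_B, what survives is the edge (s, t) itself, or a
-- forward E-edge reached by pieces of lengths exactly k_A and k_B.  Such tight pieces must go
-- down the s- and t-chains rung by rung, i.e. they form a canonical path.

open import Defs
open import Data.Nat using (ℕ; zero; suc; _+_; _∸_; _≤_; _<_; z≤n; s≤s; _/_; ⌊_/2⌋; ⌈_/2⌉)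
open import Data.Nat.Properties hiding (_≟_)
open import Data.Nat.DivMod using (m/n≡1+[m∸n]/n; m/n≤m)
open import Data.Fin using (Fin; toℕ; zero; suc; _≟_)
open import Data.Fin.Properties using (toℕ-injective; toℕ<n; toℕ≤pred[n])
open import Data.Sum using (_⊎_; inj₁; inj₂; [_,_]′)
open import Data.Sum.Properties using (≡-dec)
import Data.Sum as Sum
open import Data.Product using (Σ; ∃-syntax; _×_; _,_; proj₁; proj₂)
import Data.Product as Product
open import Data.Empty using (⊥; ⊥-elim)
open import Data.Unit using (⊤; tt)
open import Function.Base using (_∘′_)
open import Function.Definitions using (Injective)
open import Relation.Nullary using (¬_; Dec; yes; no)
open import Relation.Nullary.Decidable using (_×-dec_; _⊎-dec_)
open import Relation.Binary.Definitions using (DecidableEquality)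
open import Relation.Binary.PropositionalEquality

m/2≡⌊m/2⌋ : ∀ m → m / 2 ≡ ⌊ m /2⌋
m/2≡⌊m/2⌋ zero = refl
m/2≡⌊m/2⌋ (suc zero) = refl
m/2≡⌊m/2⌋ (suc (suc m)) =
  trans (m/n≡1+[m∸n]/n {suc (suc m)} {2} (s≤s (s≤s z≤n))) (cong suc (m/2≡⌊m/2⌋ m))

⌈n/2⌉≤1+⌊n/2⌋ : ∀ n → ⌈ n /2⌉ ≤ suc ⌊ n /2⌋
⌈n/2⌉≤1+⌊n/2⌋ zero = z≤n
⌈n/2⌉≤1+⌊n/2⌋ (suc zero) = s≤s z≤n
⌈n/2⌉≤1+⌊n/2⌋ (suc (suc n)) = s≤s (⌈n/2⌉≤1+⌊n/2⌋ n)

kA≡⌊k∸1/2⌋ : ∀ k → kA k ≡ ⌊ k ∸ 1 /2⌋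
kA≡⌊k∸1/2⌋ k = m/2≡⌊m/2⌋ (k ∸ 1)

kB≡⌈k∸1/2⌉ : ∀ k → kB k ≡ ⌈ k ∸ 1 /2⌉
kB≡⌈k∸1/2⌉ k = begin
  (k ∸ 1) ∸ kA k                      ≡⟨ cong₂ _∸_ (sym (⌊n/2⌋+⌈n/2⌉≡n (k ∸ 1))) (kA≡⌊k∸1/2⌋ k) ⟩
  (⌊ k ∸ 1 /2⌋ + ⌈ k ∸ 1 /2⌉) ∸ ⌊ k ∸ 1 /2⌋ ≡⟨ m+n∸m≡n ⌊ k ∸ 1 /2⌋ ⌈ k ∸ 1 /2⌉ ⟩
  ⌈ k ∸ 1 /2⌉                         ∎
  where open ≡-Reasoning

kA≤kB : ∀ k → kA k ≤ kB k
kA≤kB k = subst₂ _≤_ (sym (kA≡⌊k∸1/2⌋ k)) (sym (kB≡⌈k∸1/2⌉ k)) (⌊n/2⌋≤⌈n/2⌉ (k ∸ 1))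

kB≤1+kA : ∀ k → kB k ≤ suc (kA k)
kB≤1+kA k =
  subst₂ (λ a b → a ≤ suc b) (sym (kB≡⌈k∸1/2⌉ k)) (sym (kA≡⌊k∸1/2⌋ k)) (⌈n/2⌉≤1+⌊n/2⌋ (k ∸ 1))

1+kA+kB≡k : ∀ {k} → 1 ≤ k → suc (kA k + kB k) ≡ k
1+kA+kB≡k {suc k} _ = cong suc (m+[n∸m]≡n (m/n≤m k 2))

+-squeeze : ∀ {a b m n} → a ≤ m → b ≤ n → m + n ≤ a + b → m ≤ a × n ≤ b
+-squeeze {a} {b} {m} {n} a≤m b≤n m+n≤a+b =
  +-cancelʳ-≤ b m a (≤-trans (+-monoʳ-≤ m b≤n) m+n≤a+b) ,
  +-cancelˡ-≤ a n b (≤-trans (+-monoˡ-≤ n a≤m) m+n≤a+b)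

+-overshoot : ∀ {a b m n} → a < m → b ≤ n → m + n ≤ a + b → ⊥
+-overshoot a<m b≤n m+n≤a+b = 1+n≰n (≤-trans (+-mono-≤ a<m b≤n) m+n≤a+b)

suc-toℕ≡ : ∀ {n} (h : Fin n) → toℕ h ≡ n ∸ 1 → suc (toℕ h) ≡ n
suc-toℕ≡ {suc n} h eq = cong suc eq

toℕ≤n∸1 : ∀ {n} (h : Fin n) → toℕ h ≤ n ∸ 1
toℕ≤n∸1 {suc n} h = toℕ≤pred[n] h

module Walks {A : Set} (R : A → A → Set) where

  data Walk : A → A → ℕ → Set where
    []  : ∀ {a} → Walk a a 0
    _∷_ : ∀ {a b c n} → R a b → Walk b c n → Walk a c (suc n)

  _∈_ : ∀ {a b n} → A → Walk a b n → Set
  _∈_ {a} x []      = x ≡ a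
  _∈_ {a} x (_ ∷ w) = x ≡ a ⊎ x ∈ w

  Simple : ∀ {a b n} → Walk a b n → Set
  Simple []          = ⊤
  Simple {a} (_ ∷ w) = ¬ a ∈ w × Simple w

  SimpleWalk≤ : A → A → ℕ → Set
  SimpleWalk≤ a b n = ∃[ m ] m ≤ n × Σ (Walk a b m) Simple

  suffix-from : ∀ {a b n x} (w : Walk a b n) → x ∈ w → Simple w → SimpleWalk≤ x b n
  suffix-from []      refl         _       = 0 , z≤n , [] , tt
  suffix-from (r ∷ w) (inj₁ refl)  simple  = _ , ≤-refl , r ∷ w , simple
  suffix-from (r ∷ w) (inj₂ x∈w)  (_ , simple) with suffix-from w x∈w simple
  ... | m , m≤n , w′ , simple′ = m , m≤n⇒m≤1+n m≤n , w′ , simple′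

  module _ (_≟ᴬ_ : DecidableEquality A) where

    _∈?_ : ∀ {a b n} x (w : Walk a b n) → Dec (x ∈ w)
    _∈?_ {a} x []      = x ≟ᴬ a
    _∈?_ {a} x (_ ∷ w) = (x ≟ᴬ a) ⊎-dec (x ∈? w)

    loop-erase : ∀ {a b n} → Walk a b n → SimpleWalk≤ a b n
    loop-erase []           = 0 , z≤n , [] , tt
    loop-erase {a} (r ∷ w) with loop-erase w
    ... | m , m≤n , w′ , simple with a ∈? w′
    ...   | no a∉w′  = suc m , s≤s m≤n , r ∷ w′ , a∉w′ , simple
    ...   | yes a∈w′ with suffix-from w′ a∈w′ simple
    ...     | m′ , m′≤m , w″ , simple″ = m′ , m≤n⇒m≤1+n (≤-trans m′≤m m≤n) , w″ , simple″

  vertex : ∀ {a b n} → Walk a b n → Fin (suc n) → A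
  vertex {a} _ zero    = a
  vertex (_ ∷ w) (suc t) = vertex w t

  vertex-∈ : ∀ {a b n} (w : Walk a b n) t → vertex w t ∈ w
  vertex-∈ []      zero    = refl
  vertex-∈ (_ ∷ w) zero    = inj₁ refl
  vertex-∈ (_ ∷ w) (suc t) = inj₂ (vertex-∈ w t)

  vertex-injective : ∀ {a b n} (w : Walk a b n) → Simple w → Injective _≡_ _≡_ (vertex w)
  vertex-injective w       _            {zero}  {zero}  _  = refl
  vertex-injective (_ ∷ w) (a∉w , _)    {zero}  {suc t} eq =
    ⊥-elim (a∉w (subst (_∈ w) (sym eq) (vertex-∈ w t)))
  vertex-injective (_ ∷ w) (a∉w , _)    {suc s} {zero}  eq =
    ⊥-elim (a∉w (subst (_∈ w) eq (vertex-∈ w s)))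
  vertex-injective (_ ∷ w) (_ , simple) {suc s} {suc t} eq = cong suc (vertex-injective w simple eq)

  vertex-first : ∀ {a b n} (w : Walk a b n) t → toℕ t ≡ 0 → vertex w t ≡ a
  vertex-first w zero _ = refl

  vertex-last : ∀ {a b n} (w : Walk a b n) t → toℕ t ≡ n → vertex w t ≡ b
  vertex-last []      zero    _  = refl
  vertex-last (_ ∷ w) (suc t) eq = vertex-last w t (suc-injective eq)

  vertex-step : ∀ {a b n} (w : Walk a b n) s t → toℕ t ≡ suc (toℕ s) → R (vertex w s) (vertex w t)
  vertex-step (_∷_ {a = a} r w) zero    (suc t) eq =
    subst (R a) (sym (vertex-first w t (suc-injective eq))) r
  vertex-step (_ ∷ w)           (suc s) (suc t) eq = vertex-step w s t (suc-injective eq)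

module SuperPaths (I : MinRep) where
  open MinRep I
  open Super I
  open Walks
    using (Walk; []; _∷_; Simple; vertex; vertex-injective; vertex-step; vertex-first; vertex-last)

  _≟ˢ_ : DecidableEquality SV
  _≟ˢ_ = ≡-dec _≟_ _≟_

  Crosses : SV → SV → SV → SV → Set
  Crosses a b x y = (x ≡ a × y ≡ b) ⊎ (x ≡ b × y ≡ a)

  crosses? : ∀ a b x y → Dec (Crosses a b x y)
  crosses? a b x y = ((x ≟ˢ a) ×-dec (y ≟ˢ b)) ⊎-dec ((x ≟ˢ b) ×-dec (y ≟ˢ a))

  Avoiding : SV → SV → SV → SV → Set
  Avoiding a b x y = SAdj x y × ¬ Crosses a b x y

  girth≤1+closed-path : ∀ {g a b m} {R : SV → SV → Set} → GirthAtLeast g →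
                        (∀ {x y} → R x y → SAdj x y) → SAdj b a →
                        (w : Walk R a b m) → Simple R w → 2 ≤ m → g ≤ suc m
  girth≤1+closed-path {R = R} girth R⊆SAdj b~a w simple 2≤m = girth _ (vertex R w) (record
    { long  = s≤s 2≤m
    ; inj   = vertex-injective R w simple
    ; step  = λ s t t≡1+s → R⊆SAdj (vertex-step R w s t t≡1+s)
    ; close = λ s t s-last t-first →
        subst₂ SAdj (sym (vertex-last R w s s-last)) (sym (vertex-first R w t t-first)) b~a
    })

  avoiding-walk-length≥2 : ∀ {i j m} → Walk (Avoiding (inj₁ i) (inj₂ j)) (inj₁ i) (inj₂ j) m → 2 ≤ m
  avoiding-walk-length≥2 ((_ , ¬crosses) ∷ [])  = ⊥-elim (¬crosses (inj₁ (refl , refl)))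
  avoiding-walk-length≥2 (_ ∷ (_ ∷ _))         = s≤s (s≤s z≤n)

  girth≤1+avoiding-walk : ∀ {g i j m} → GirthAtLeast g → superE i j →
                          Walk (Avoiding (inj₁ i) (inj₂ j)) (inj₁ i) (inj₂ j) m → g ≤ suc m
  girth≤1+avoiding-walk girth i~j w with Walks.loop-erase _ _≟ˢ_ w
  ... | m′ , m′≤m , w′ , simple =
    ≤-trans (girth≤1+closed-path girth proj₁ i~j w′ simple (avoiding-walk-length≥2 w′)) (s≤s m′≤m)

Near : ℕ → ℕ → Set
Near m n = m ≤ suc n × n ≤ suc m

near-suc : ∀ {m n} → n ≡ suc m → Near m n
near-suc {m} refl = m≤n⇒m≤1+n (n≤1+n m) , ≤-refl

module Spanning (k : ℕ) (I : MinRep) where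
  open MinRep I
  open Super I
  open SuperPaths I
  open Construction k I

  super : V → SV
  super (va i _)   = inj₁ i
  super (vb j _)   = inj₂ j
  super (vs i _ _) = inj₁ i
  super (vt j _ _) = inj₂ j

  super-edge : ∀ {u v} → Edge u v → super u ≡ super v ⊎ SAdj (super u) (super v)
  super-edge (eE i~j _)   = inj₂ i~j
  super-edge (eG i~j _ _) = inj₂ i~j
  super-edge (eMs _)      = inj₁ refl
  super-edge (eMt _)      = inj₁ refl
  super-edge (esA _)      = inj₁ refl
  super-edge (etB _)      = inj₁ refl

  SAdj-sym : ∀ {a b} → SAdj a b → SAdj b a
  SAdj-sym {inj₁ _} {inj₂ _} a~b = a~b
  SAdj-sym {inj₂ _} {inj₁ _} a~b = a~b

  super-adj : ∀ {u v} → Adj u v → super u ≡ super v ⊎ SAdj (super u) (super v)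
  super-adj (inj₁ e) = super-edge e
  super-adj {u} {v} (inj₂ e) = Sum.map sym (SAdj-sym {super v} {super u}) (super-edge e)

  data Over (i j : Fin N) : V → V → Set where
    layer : ∀ {α β} → rel i j α β → Over i j (va i α) (vb j β)
    copy  : ∀ {h h′ q} → toℕ h ≡ kA k ∸ 1 → toℕ h′ ≡ kB k ∸ 1 → Over i j (vs i h q) (vt j h′ q)

  over : ∀ {i j u v} → Adj u v → super u ≡ inj₁ i → super v ≡ inj₂ j → Over i j u v
  over (inj₁ (eE _ r))     refl refl = layer r
  over (inj₁ (eG _ e₁ e₂)) refl refl = copy e₁ e₂
  over (inj₁ (eMs _))      _    ()
  over (inj₁ (eMt _))      ()   _
  over (inj₁ (esA _))      _    ()
  over (inj₁ (etB _))      ()   _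
  over (inj₂ (eE _ _))     ()   _
  over (inj₂ (eG _ _ _))   ()   _
  over (inj₂ (eMs _))      _    ()
  over (inj₂ (eMt _))      ()   _
  over (inj₂ (esA _))      _    ()
  over (inj₂ (etB _))      ()   _

  over-crossing : ∀ {i j u v} → Adj u v → Crosses (inj₁ i) (inj₂ j) (super u) (super v) →
                  Over i j u v ⊎ Over i j v u
  over-crossing u~v (inj₁ (u↦i , v↦j)) = inj₁ (over u~v u↦i v↦j)
  over-crossing u~v (inj₂ (u↦j , v↦i)) = inj₂ (over (Sum.swap u~v) v↦i u↦j)

  _∷ʳ_ : ∀ {R : V → V → Set} {u v w ℓ} → Walk R u v ℓ → R v w → Walk R u w (suc ℓ)
  []      ∷ʳ r = r ∷ []
  (r′ ∷ W) ∷ʳ r = r′ ∷ (W ∷ʳ r)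

  reverse : ∀ {R : V → V → Set} → (∀ {u v} → R u v → R v u) →
            ∀ {u v ℓ} → Walk R u v ℓ → Walk R v u ℓ
  reverse R-sym []      = []
  reverse R-sym (r ∷ W) = reverse R-sym W ∷ʳ R-sym r

  potential≤length : ∀ {R : V → V → Set} (f : V → ℕ) → (∀ {u v} → R u v → f u ≤ suc (f v)) →
                     ∀ {u v ℓ} → Walk R u v ℓ → f v ≡ 0 → f u ≤ ℓ
  potential≤length f lip []      fv≡0 = ≤-reflexive fv≡0
  potential≤length f lip (r ∷ W) fv≡0 = ≤-trans (lip r) (s≤s (potential≤length f lip W fv≡0))

  Lipschitz : (V → ℕ) → Set
  Lipschitz f = ∀ {u v} → Edge u v → Near (f u) (f v)

  -- Lower bounds on the distances in G′ to the Min-Rep layer, to B × Σ_B and to the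
  -- copies other than p.
  dLayer : V → ℕ
  dLayer (va _ _)   = 0
  dLayer (vb _ _)   = 0
  dLayer (vs _ h _) = suc (toℕ h)
  dLayer (vt _ h _) = suc (toℕ h)

  dB : V → ℕ
  dB (va _ _)   = 1
  dB (vb _ _)   = 0
  dB (vs _ h _) = suc (suc (toℕ h))
  dB (vt _ h _) = suc (toℕ h)

  onCopy : Fin x → Fin x → ℕ → ℕ
  onCopy p q n with q ≟ p
  ... | yes _ = n
  ... | no  _ = 0

  dOther : Fin x → V → ℕ
  dOther p (va _ _)   = 1
  dOther p (vb _ _)   = 1
  dOther p (vs _ h q) = onCopy p q (suc (suc (toℕ h)))
  dOther p (vt _ h q) = onCopy p q (suc (suc (toℕ h)))

  near-onCopy : ∀ p q {m n} → Near m n → Near (onCopy p q m) (onCopy p q n)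
  near-onCopy p q m~n with q ≟ p
  ... | yes _ = m~n
  ... | no  _ = z≤n , z≤n

  onCopy≤ : ∀ p q n → onCopy p q n ≤ n
  onCopy≤ p q n with q ≟ p
  ... | yes _ = ≤-refl
  ... | no  _ = z≤n

  onCopy-self : ∀ p n → onCopy p p n ≡ n
  onCopy-self p n with p ≟ p
  ... | yes _   = refl
  ... | no  p≢p = ⊥-elim (p≢p refl)

  onCopy-other : ∀ {p q} n → ¬ q ≡ p → onCopy p q n ≡ 0
  onCopy-other {p} {q} n q≢p with q ≟ p
  ... | yes q≡p = ⊥-elim (q≢p q≡p)
  ... | no  _   = refl

  near-kA-kB : Near (kA k) (kB k)
  near-kA-kB = m≤n⇒m≤1+n (kA≤kB k) , kB≤1+kA k

  dLayer-lipschitz : Lipschitz dLayer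
  dLayer-lipschitz (eE _ _)  = z≤n , z≤n
  dLayer-lipschitz (eMs eq)  = near-suc (cong suc eq)
  dLayer-lipschitz (eMt eq)  = near-suc (cong suc eq)
  dLayer-lipschitz (esA eq) rewrite eq = Product.swap (near-suc refl)
  dLayer-lipschitz (etB eq) rewrite eq = near-suc refl
  dLayer-lipschitz (eG _ e₁ e₂) rewrite suc-toℕ≡ _ e₁ | suc-toℕ≡ _ e₂ = near-kA-kB

  dB-lipschitz : Lipschitz dB
  dB-lipschitz (eE _ _)  = ≤-refl , z≤n
  dB-lipschitz (eMs eq)  = near-suc (cong (suc ∘′ suc) eq)
  dB-lipschitz (eMt eq)  = near-suc (cong suc eq)
  dB-lipschitz (esA eq) rewrite eq = Product.swap (near-suc refl)
  dB-lipschitz (etB eq) rewrite eq = near-suc refl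
  dB-lipschitz (eG _ e₁ e₂) rewrite suc-toℕ≡ _ e₁ | suc-toℕ≡ _ e₂ =
    s≤s (kA≤kB k) , m≤n⇒m≤1+n (kB≤1+kA k)

  dOther-lipschitz : ∀ p → Lipschitz (dOther p)
  dOther-lipschitz p (eE _ _) = n≤1+n 1 , n≤1+n 1
  dOther-lipschitz p (eMs {p = q} eq) = near-onCopy p q (near-suc (cong (suc ∘′ suc) eq))
  dOther-lipschitz p (eMt {p = q} eq) = near-onCopy p q (near-suc (cong (suc ∘′ suc) eq))
  dOther-lipschitz p (esA {p = q} eq) rewrite eq = onCopy≤ p q 2 , s≤s z≤n
  dOther-lipschitz p (etB {p = q} eq) rewrite eq = s≤s z≤n , onCopy≤ p q 2
  dOther-lipschitz p (eG {p = q} _ e₁ e₂) rewrite suc-toℕ≡ _ e₁ | suc-toℕ≡ _ e₂ =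
    near-onCopy p q (Product.map s≤s s≤s near-kA-kB)

  module Ladder (R : V → V → Set) (f : V → ℕ) (lip : ∀ {u v} → R u v → f u ≤ suc (f v))
                {K : ℕ} (rung : Fin K → V) (rung-height : ∀ h → f (rung h) ≡ suc (toℕ h))
                (descend : ∀ {h v} → R (rung h) v → f v ≤ toℕ h → 0 < toℕ h →
                           ∃[ h′ ] toℕ h ≡ suc (toℕ h′) × v ≡ rung h′) where

    Descended : Fin K → V → Set
    Descended h t =
        (∀ j₁ j₂ → toℕ j₂ ≡ suc (toℕ j₁) → toℕ j₂ ≤ toℕ h → R (rung j₂) (rung j₁))
      × (∀ j₁ → toℕ j₁ ≡ 0 → R (rung j₁) t)

    extend-descent : ∀ {h h′ t} → R (rung h) (rung h′) → toℕ h ≡ suc (toℕ h′) →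
                     Descended h′ t → Descended h t
    extend-descent {h} {h′} r h≡1+h′ (rungs , foot) = rungs′ , foot
      where
        rungs′ : ∀ j₁ j₂ → toℕ j₂ ≡ suc (toℕ j₁) → toℕ j₂ ≤ toℕ h → R (rung j₂) (rung j₁)
        rungs′ j₁ j₂ j₂≡1+j₁ j₂≤h with j₂ ≟ h
        ... | yes refl = subst (λ h″ → R (rung h) (rung h″))
                           (toℕ-injective (suc-injective (trans (sym h≡1+h′) j₂≡1+j₁))) r
        ... | no  j₂≢h = rungs j₁ j₂ j₂≡1+j₁
                           (≤-pred (subst (toℕ j₂ <_) h≡1+h′ (≤∧≢⇒< j₂≤h (j₂≢h ∘′ toℕ-injective))))

    -- A walk from rung h down to potential 0 has length at least 1 + h; if it is no
    -- longer, every step must lower f by one, and only the next rung does that.  The start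
    -- vertex is given up to an equation so that the recursion stays structural on the walk.
    descend-ladder : ∀ {h v t ℓ} → v ≡ rung h → f t ≡ 0 → Walk R v t ℓ → ℓ ≤ suc (toℕ h) →
                     Descended h t
    descend-ladder {h} refl ft≡0 [] _ = ⊥-elim (1+n≢0 (trans (sym (rung-height h)) ft≡0))
    descend-ladder {h} {t = t} refl ft≡0 (r ∷ []) _ = no-rungs-below , foot
      where
        h≡0 : toℕ h ≡ 0
        h≡0 = n≤0⇒n≡0 (≤-pred (subst₂ _≤_ (rung-height h) (cong suc ft≡0) (lip r)))
        no-rungs-below : ∀ j₁ j₂ → toℕ j₂ ≡ suc (toℕ j₁) → toℕ j₂ ≤ toℕ h → R (rung j₂) (rung j₁)
        no-rungs-below _ j₂ j₂≡1+j₁ j₂≤h = ⊥-elim (n≮0 (subst₂ _≤_ j₂≡1+j₁ h≡0 j₂≤h))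
        foot : ∀ j₁ → toℕ j₁ ≡ 0 → R (rung j₁) t
        foot j₁ j₁≡0 = subst (λ h′ → R (rung h′) t) (toℕ-injective (trans h≡0 (sym j₁≡0))) r
    descend-ladder {h} refl ft≡0 (r ∷ W@(_ ∷ _)) (s≤s ℓ≤h) =
      let h′ , h≡1+h′ , v≡rung = descend r (≤-trans (potential≤length f lip W ft≡0) ℓ≤h)
                                           (≤-trans (s≤s z≤n) ℓ≤h)
      in extend-descent (subst (R (rung h)) v≡rung r) h≡1+h′
                        (descend-ladder v≡rung ft≡0 W (subst (_ ≤_) h≡1+h′ ℓ≤h))

  s-chain-descends : ∀ {i h p v} → Adj (vs i h p) v → dLayer v ≤ toℕ h → 0 < toℕ h →
                     ∃[ h′ ] toℕ h ≡ suc (toℕ h′) × v ≡ vs i h′ p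
  s-chain-descends (inj₁ (eMs eq)) v≤h _ =
    ⊥-elim (1+n≰n (≤-trans (n≤1+n _) (subst (λ z → suc z ≤ _) eq v≤h)))
  s-chain-descends (inj₁ (esA eq)) _ 0<h = ⊥-elim (<-irrefl (sym eq) 0<h)
  s-chain-descends {h = h} (inj₁ (eG _ _ e₂)) v≤h _ =
    ⊥-elim (1+n≰n (≤-trans (toℕ<n h) (≤-trans (kA≤kB k) (subst (_≤ toℕ h) (suc-toℕ≡ _ e₂) v≤h))))
  s-chain-descends (inj₂ (eMs eq)) _ _ = _ , eq , refl

  t-chain-descends : ∀ {j h p v} → Adj (vt j h p) v → dB v ≤ toℕ h → 0 < toℕ h →
                     ∃[ h′ ] toℕ h ≡ suc (toℕ h′) × v ≡ vt j h′ p
  t-chain-descends (inj₁ (eMt eq)) v≤h _ =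
    ⊥-elim (1+n≰n (≤-trans (n≤1+n _) (subst (λ z → suc z ≤ _) eq v≤h)))
  t-chain-descends (inj₂ (etB eq)) _ 0<h = ⊥-elim (<-irrefl (sym eq) 0<h)
  t-chain-descends {h = h} (inj₂ (eG _ e₁ _)) v≤h _ =
    ⊥-elim (1+n≰n (≤-trans (toℕ<n h)
      (≤-trans (kB≤1+kA k) (subst (λ z → suc z ≤ toℕ h) (suc-toℕ≡ _ e₁) v≤h))))
  t-chain-descends (inj₂ (eMt eq)) _ _ = _ , eq , refl

  module InSubgraph {H : V → V → Set} (H-subgraph : IsSubgraph H) where
    open IsSubgraph H-subgraph

    H-lipschitz : ∀ {f} → Lipschitz f → ∀ {u v} → H u v → f u ≤ suc (f v)
    H-lipschitz lip h = [ (λ e → proj₁ (lip e)) , (λ e → proj₂ (lip e)) ]′ (sub h)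

    start≤length : ∀ f → Lipschitz f → ∀ {u v ℓ} → Walk H u v ℓ → f v ≡ 0 → f u ≤ ℓ
    start≤length f lip = potential≤length f (H-lipschitz lip)

    end≤length : ∀ f → Lipschitz f → ∀ {u v ℓ} → Walk H u v ℓ → f u ≡ 0 → f v ≤ ℓ
    end≤length f lip W = start≤length f lip (reverse sym-H W)

    record Crossing (a b : SV) (u v : V) (ℓ : ℕ) : Set where
      constructor crossing
      field
        {from to} : V
        {ℓ₁ ℓ₂}   : ℕ
        before    : Walk H u from ℓ₁
        edge      : H from to
        after     : Walk H to v ℓ₂
        length    : suc (ℓ₁ + ℓ₂) ≡ ℓ
        crosses   : Crosses a b (super from) (super to)

    crossing-or-avoiding : ∀ {a b u v ℓ} → Walk H u v ℓ →
      Crossing a b u v ℓ ⊎ ∃[ m ] m ≤ ℓ × Walks.Walk (Avoiding a b) (super u) (super v) m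
    crossing-or-avoiding [] = inj₂ (0 , z≤n , Walks.[])
    crossing-or-avoiding {a} {b} {u} (_∷_ {v = w} h W) with crossing-or-avoiding W
    ... | inj₁ (crossing W₁ e W₂ len c) = inj₁ (crossing (h ∷ W₁) e W₂ (cong suc len) c)
    ... | inj₂ (m , m≤ℓ , w̃) with crosses? a b (super u) (super w)
    ...   | yes c = inj₁ (crossing [] h W refl c)
    ...   | no ¬c with super-adj (sub h)
    ...     | inj₁ same = inj₂ (m , m≤n⇒m≤1+n m≤ℓ , subst (λ z → Walks.Walk _ z _ m) (sym same) w̃)
    ...     | inj₂ u~w  = inj₂ (suc m , s≤s m≤ℓ , (u~w , ¬c) Walks.∷ w̃)

    module AtSuperedge {i j : Fin N} {p : Fin x} {ji : Fin (kA k)} {jj : Fin (kB k)}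
                       (ji-top : toℕ ji ≡ kA k ∸ 1) (jj-top : toℕ jj ≡ kB k ∸ 1) where

      s₀ t₀ : V
      s₀ = vs i ji p
      t₀ = vt j jj p

      ji-height : suc (toℕ ji) ≡ kA k
      ji-height = suc-toℕ≡ ji ji-top

      jj-height : suc (toℕ jj) ≡ kB k
      jj-height = suc-toℕ≡ jj jj-top

      module S = Ladder H dLayer (H-lipschitz dLayer-lipschitz) (λ h → vs i h p) (λ _ → refl)
                        (λ h → s-chain-descends (sub h))
      module T = Ladder H dB (H-lipschitz dB-lipschitz) (λ h → vt j h p) (λ _ → refl)
                        (λ h → t-chain-descends (sub h))

      via-layer-edge : ∀ {α β ℓ₁ ℓ₂} → rel i j α β →
                       Walk H s₀ (va i α) ℓ₁ → H (va i α) (vb j β) → Walk H (vb j β) t₀ ℓ₂ →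
                       ℓ₁ + ℓ₂ ≤ kA k + kB k → CanonicalSpanned H i j p
      via-layer-edge {α} {β} {ℓ₁} {ℓ₂} r W₁ e W₂ short =
        _ , _ , r ,
        (λ j₁ j₂ step → proj₁ s-descent j₁ j₂ step (subst (_ ≤_) (sym ji-top) (toℕ≤n∸1 j₂))) ,
        proj₂ s-descent , e ,
        (λ j₁ j₁≡0 → sym-H (proj₂ t-descent j₁ j₁≡0)) ,
        (λ j₁ j₂ step → sym-H (proj₁ t-descent j₁ j₂ step (subst (_ ≤_) (sym jj-top) (toℕ≤n∸1 j₂))))
        where
          tight : ℓ₁ ≤ kA k × ℓ₂ ≤ kB k
          tight = +-squeeze (subst (_≤ ℓ₁) ji-height (start≤length dLayer dLayer-lipschitz W₁ refl))
                            (subst (_≤ ℓ₂) jj-height (end≤length dB dB-lipschitz W₂ refl)) short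
          s-descent : S.Descended ji (va i α)
          s-descent = S.descend-ladder refl refl W₁ (subst (ℓ₁ ≤_) (sym ji-height) (proj₁ tight))
          t-descent : T.Descended jj (vb j β)
          t-descent = T.descend-ladder refl refl (reverse sym-H W₂)
                                       (subst (ℓ₂ ≤_) (sym jj-height) (proj₂ tight))

      reversed-layer-edge-too-long : ∀ {α β ℓ₁ ℓ₂} →
        Walk H s₀ (vb j β) ℓ₁ → Walk H (va i α) t₀ ℓ₂ → ℓ₁ + ℓ₂ ≤ kA k + kB k → ⊥
      reversed-layer-edge-too-long {ℓ₁ = ℓ₁} {ℓ₂} W₁ W₂ =
        +-overshoot (subst (_≤ ℓ₁) (cong suc ji-height) (start≤length dB dB-lipschitz W₁ refl))
                    (subst (_≤ ℓ₂) jj-height (end≤length dLayer dLayer-lipschitz W₂ refl))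

      other-copy-too-long : ∀ {u v ℓ₁ ℓ₂} → Walk H s₀ u ℓ₁ → Walk H v t₀ ℓ₂ →
        dOther p u ≡ 0 → dOther p v ≡ 0 → ℓ₁ + ℓ₂ ≤ kA k + kB k → ⊥
      other-copy-too-long {ℓ₁ = ℓ₁} {ℓ₂} W₁ W₂ u-away v-away =
        +-overshoot (subst (_≤ ℓ₁) (trans (onCopy-self p _) (cong suc ji-height))
                                  (start≤length (dOther p) (dOther-lipschitz p) W₁ u-away))
                    (≤-trans (n≤1+n _)
                      (subst (_≤ ℓ₂) (trans (onCopy-self p _) (cong suc jj-height))
                                    (end≤length (dOther p) (dOther-lipschitz p) W₂ v-away)))

      copy-edge : ∀ {h h′} → toℕ h ≡ kA k ∸ 1 → toℕ h′ ≡ kB k ∸ 1 →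
                  H (vs i h p) (vt j h′ p) → H s₀ t₀
      copy-edge e₁ e₂ = subst₂ (λ a b → H (vs i a p) (vt j b p))
                          (toℕ-injective (trans e₁ (sym ji-top)))
                          (toℕ-injective (trans e₂ (sym jj-top)))

      resolve-crossing : ∀ {ℓ} → Crossing (inj₁ i) (inj₂ j) s₀ t₀ ℓ → ℓ ≤ suc (kA k + kB k) →
                         H s₀ t₀ ⊎ CanonicalSpanned H i j p
      resolve-crossing (crossing W₁ e W₂ refl c) (s≤s short) with over-crossing (sub e) c
      ... | inj₁ (layer r) = inj₂ (via-layer-edge r W₁ e W₂ short)
      ... | inj₂ (layer _) = ⊥-elim (reversed-layer-edge-too-long W₁ W₂ short)
      ... | inj₁ (copy {q = q} e₁ e₂) with q ≟ p
      ...   | yes refl = inj₁ (copy-edge e₁ e₂ e)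
      ...   | no  q≢p  =
        ⊥-elim (other-copy-too-long W₁ W₂ (onCopy-other _ q≢p) (onCopy-other _ q≢p) short)
      resolve-crossing (crossing W₁ e W₂ refl c) (s≤s short)
        | inj₂ (copy {q = q} e₁ e₂) with q ≟ p
      ...   | yes refl = inj₁ (copy-edge e₁ e₂ (sym-H e))
      ...   | no  q≢p  =
        ⊥-elim (other-copy-too-long W₁ W₂ (onCopy-other _ q≢p) (onCopy-other _ q≢p) short)

lemma6 : (k : ℕ) → 3 ≤ k → (I : MinRep) →
         Super.GirthAtLeast I (k + 2) →
         (H : Construction.V k I → Construction.V k I → Set) →
         Construction.IsSubgraph k I H →
         Construction.IsSpanner k I H →
         ∀ (i j : Fin (MinRep.N I)) (p : Fin (Construction.x k I))
           (ji : Fin (kA k)) (jj : Fin (kB k)) →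
         MinRep.superE I i j → toℕ ji ≡ kA k ∸ 1 → toℕ jj ≡ kB k ∸ 1 →
         H (Construction.vs i ji p) (Construction.vt j jj p)
           ⊎ Construction.CanonicalSpanned k I H i j p
lemma6 k 3≤k I girth H H-subgraph spanner i j p ji jj i~j ji-top jj-top
  with spanner _ _ 1 (inj₁ (Construction.eG i~j ji-top jj-top) Construction.∷ Construction.[])
... | ℓ , ℓ≤k*1 , W =
  [ (λ c → resolve-crossing c (subst (ℓ ≤_) (sym (1+kA+kB≡k (≤-trans (s≤s z≤n) 3≤k))) ℓ≤k))
  , (λ (m , m≤ℓ , w̃) → ⊥-elim (1+n≰n (subst (_≤ suc k) (+-comm k 2)
                          (≤-trans (girth≤1+avoiding-walk girth i~j w̃) (s≤s (≤-trans m≤ℓ ℓ≤k))))))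
  ]′ (crossing-or-avoiding W)
  where
    open SuperPaths I
    open Spanning k I
    open InSubgraph H-subgraph
    open AtSuperedge ji-top jj-top
    ℓ≤k : ℓ ≤ k
    ℓ≤k = subst (ℓ ≤_) (*-identityʳ k) ℓ≤k*1
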